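{- Let $h>1$ and $p\ge 1$ be integers, let $\omega=e^{2\pi i/h}$ and $\Omega_h=\{1,\omega,\dots,\omega^{h-1}\}$. Let $L=\{l=(l_0,l_1,\dots,l_{h-1}) : l_k\in\{0,1,\dots,p-1\}\}$ and for $l\in L$ put $(\Omega_h)_l^{1/p}=\{f_{l_0}(1), f_{l_1}(\omega),\dots,f_{l_{h-1}}(\omega^{h-1})\}$. Then there exists $l\in L$ such that $(\Omega_h)_l^{1/p}=\Omega_h$ if and only if $\gcd(h,p)=1$.
   Context: For $z=re^{i\theta}\in\mathbb{C}$ put $z^{1/p}=r^{1/p}e^{i\theta/p}$, and for $l\in\{0,1,\dots,p-1\}$ let $f_l(z)=z^{1/p}e^{2\pi l i/p}=r^{1/p}e^{(\theta+2\pi l)i/p}$ (the $(l+1)$-th branch of the $p$-th root function). For $\omega^k$ with $k\in\{0,\dots,h-1\}$ the argument used is $\theta=2\pi k/h$, so $f_l(\omega^k)=e^{2\pi i (k+hl)/(hp)}$. -}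

module Defs where

open import Data.Nat using (ℕ; _+_; _*_)
open import Data.Fin using (Fin; toℕ)
open import Data.Product using (Σ; _×_)
import Data.Integer as ℤ
open import Data.Integer.Divisibility using (_∣_)

-- Roots of unity of order dividing N are encoded by exponents:
-- the natural number a stands for the complex number e^{2πi a/N}.
SameRoot : (N a b : ℕ) → Set
SameRoot N a b = ℤ.+ N ∣ (ℤ.+ a ℤ.- ℤ.+ b)

-- Everything below lives among the (h p)-th roots of unity (N = h * p).
-- ω^j = e^{2πi j/h} = e^{2πi (p j)/(h p)} : exponent p * j.
omegaExp : (h p : ℕ) → Fin h → ℕ
omegaExp h p j = p * toℕ j

-- f_m(ω^k) = e^{2πi (k + h m)/(h p)} : exponent k + h * m
-- (using the argument θ = 2πk/h for ω^k, as fixed in the context).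
branchExp : (h p : ℕ) → Fin h → Fin p → ℕ
branchExp h p k m = toℕ k + h * toℕ m

L : (h p : ℕ) → Set
L h p = Fin h → Fin p

RootSetEqOmega : (h p : ℕ) → L h p → Set
RootSetEqOmega h p l =
  ((k : Fin h) → Σ (Fin h) λ j → SameRoot (h * p) (branchExp h p k (l k)) (omegaExp h p j))
  × ((j : Fin h) → Σ (Fin h) λ k → SameRoot (h * p) (branchExp h p k (l k)) (omegaExp h p j))

{-# OPTIONS --safe #-}
-- If d divides h and p, the branch at ω gives 1 + hm ≡ pj (mod hp), hence 1 ≡ 0 (mod d).
-- Conversely, for coprime h and p choose l_k ≡ -k h⁻¹ (mod p): then k + h l_k is divisible
-- by p and congruent to k mod h, so by the Chinese remainder theorem it equals pj mod hp
-- exactly when k ≡ pj (mod h); both inclusions follow, via j = k p⁻¹ and k = pj mod h.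
module Submission where

open import Defs
open import Data.Nat using (ℕ; _<_; _≤_; suc; s≤s; z≤n; NonZero)
open import Data.Nat.GCD using (gcd)
open import Data.Product using (Σ; _,_; proj₁; proj₂)
open import Function.Bundles using (_⇔_; mk⇔)
open import Relation.Binary.PropositionalEquality using (_≡_; sym; trans; cong; subst; module ≡-Reasoning)

import Data.Nat as ℕ
import Data.Nat.Divisibility as ℕ
open import Data.Nat.Coprimality as Coprimality using (Coprime; coprime-Bézout; coprime⇒gcd≡1; gcd≡1⇒coprime)
open import Data.Nat.GCD using (module Bézout)
open import Data.Fin using (Fin; toℕ; fromℕ<)
import Data.Fin as Fin
open import Data.Fin.Properties using (toℕ-fromℕ<)
open import Data.Integer using (ℤ; +_; _+_; _*_; _-_; -_)
open import Data.Integer.Properties using (pos-+; pos-*; *-comm; +-identityʳ; *-identityʳ)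
open import Data.Integer.DivMod using (_%ℕ_; _/ℕ_; n%ℕd<d; a≡a%ℕn+[a/ℕn]*n)
import Data.Integer.Coprimality as ℤ
open import Data.Integer.Divisibility.Signed using (_∣_; divides; ∣ᵤ⇒∣; ∣⇒∣ᵤ; ∣-trans; ∣m∣n⇒∣m+n; ∣m⇒∣-m; ∣n⇒∣m*n; ∣m⇒∣m*n)
open import Data.Integer.Tactic.RingSolver using (solve-∀)
open import Relation.Binary.Bundles using (Setoid)
open import Relation.Binary.Structures using (IsEquivalence)
import Relation.Binary.Reasoning.Setoid as SetoidReasoning

infix 4 _≈_mod_

record _≈_mod_ (a b : ℤ) (n : ℕ) : Set where
  constructor ≈-mod
  field ∣-difference : + n ∣ a - b

module _ {n : ℕ} where

  ≈-mod-refl : ∀ {a} → a ≈ a mod n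
  ≈-mod-refl {a} = ≈-mod (divides (+ 0) (a-a≡0*n a (+ n)))
    where
    a-a≡0*n : ∀ a m → a - a ≡ + 0 * m
    a-a≡0*n = solve-∀

  ≈-mod-sym : ∀ {a b} → a ≈ b mod n → b ≈ a mod n
  ≈-mod-sym {a} {b} (≈-mod n∣a-b) = ≈-mod (subst (+ n ∣_) (negate-diff a b) (∣m⇒∣-m n∣a-b))
    where
    negate-diff : ∀ a b → - (a - b) ≡ b - a
    negate-diff = solve-∀

  ≈-mod-trans : ∀ {a b c} → a ≈ b mod n → b ≈ c mod n → a ≈ c mod n
  ≈-mod-trans {a} {b} {c} (≈-mod n∣a-b) (≈-mod n∣b-c) =
    ≈-mod (subst (+ n ∣_) (telescope a b c) (∣m∣n⇒∣m+n n∣a-b n∣b-c))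
    where
    telescope : ∀ a b c → (a - b) + (b - c) ≡ a - c
    telescope = solve-∀

  ≈-mod-isEquivalence : IsEquivalence (_≈_mod n)
  ≈-mod-isEquivalence = record { refl = ≈-mod-refl ; sym = ≈-mod-sym ; trans = ≈-mod-trans }

  ∣⇒≈0-mod : ∀ {a} → + n ∣ a → a ≈ + 0 mod n
  ∣⇒≈0-mod {a} n∣a = ≈-mod (subst (+ n ∣_) (a≡a-0 a) n∣a)
    where
    a≡a-0 : ∀ a → a ≡ a - + 0
    a≡a-0 = solve-∀

  ≈0-mod⇒∣ : ∀ {a} → a ≈ + 0 mod n → + n ∣ a
  ≈0-mod⇒∣ {a} (≈-mod n∣a-0) = subst (+ n ∣_) (a-0≡a a) n∣a-0
    where
    a-0≡a : ∀ a → a - + 0 ≡ a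
    a-0≡a = solve-∀

  +-cong-mod : ∀ {a b c d} → a ≈ b mod n → c ≈ d mod n → a + c ≈ b + d mod n
  +-cong-mod {a} {b} {c} {d} (≈-mod n∣a-b) (≈-mod n∣c-d) =
    ≈-mod (subst (+ n ∣_) (regroup a b c d) (∣m∣n⇒∣m+n n∣a-b n∣c-d))
    where
    regroup : ∀ a b c d → (a - b) + (c - d) ≡ (a + c) - (b + d)
    regroup = solve-∀

  *-cong-mod : ∀ {a b c d} → a ≈ b mod n → c ≈ d mod n → a * c ≈ b * d mod n
  *-cong-mod {a} {b} {c} {d} (≈-mod n∣a-b) (≈-mod n∣c-d) =
    ≈-mod (subst (+ n ∣_) (regroup a b c d) (∣m∣n⇒∣m+n (∣m⇒∣m*n c n∣a-b) (∣n⇒∣m*n b n∣c-d)))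
    where
    regroup : ∀ a b c d → (a - b) * c + b * (c - d) ≡ a * c - b * d
    regroup = solve-∀

  +-congˡ-mod : ∀ a {c d} → c ≈ d mod n → a + c ≈ a + d mod n
  +-congˡ-mod a = +-cong-mod (≈-mod-refl {a})

  *-congˡ-mod : ∀ a {c d} → c ≈ d mod n → a * c ≈ a * d mod n
  *-congˡ-mod a = *-cong-mod (≈-mod-refl {a})

  multiple≈0-mod : ∀ a → + n * a ≈ + 0 mod n
  multiple≈0-mod a = ∣⇒≈0-mod (∣m⇒∣m*n a (divides (+ 1) (n≡1*n (+ n))))
    where
    n≡1*n : ∀ m → m ≡ + 1 * m
    n≡1*n = solve-∀

≈-mod-setoid : ℕ → Setoid _ _
≈-mod-setoid n = record { isEquivalence = ≈-mod-isEquivalence {n} }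

module ≈-mod-Reasoning (n : ℕ) = SetoidReasoning (≈-mod-setoid n)

≈-mod-weaken : ∀ {d n a b} → d ℕ.∣ n → a ≈ b mod n → a ≈ b mod d
≈-mod-weaken d∣n (≈-mod n∣a-b) = ≈-mod (∣-trans (∣ᵤ⇒∣ d∣n) n∣a-b)

≈-mod-*-coprime : ∀ {m n a b} → Coprime m n →
  a ≈ b mod m → a ≈ b mod n → a ≈ b mod m ℕ.* n
≈-mod-*-coprime {m} {n} {a} {b} m⊥n (≈-mod (divides q a-b≡q*m)) (≈-mod n∣a-b) =
  ≈-mod (divides r (begin
    a - b               ≡⟨ a-b≡q*m ⟩
    q * + m             ≡⟨ cong (_* + m) q≡r*n ⟩
    r * + n * + m       ≡⟨ reassoc r (+ n) (+ m) ⟩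
    r * (+ m * + n)     ≡⟨ cong (r *_) (sym (pos-* m n)) ⟩
    r * + (m ℕ.* n)     ∎))
  where
  open ≡-Reasoning
  n∣q : + n ∣ q
  n∣q = ∣ᵤ⇒∣ (ℤ.coprime-divisor (+ n) (+ m) q (Coprimality.sym m⊥n)
          (∣⇒∣ᵤ (subst (+ n ∣_) (trans a-b≡q*m (*-comm q (+ m))) n∣a-b)))
  r : ℤ
  r = _∣_.quotient n∣q
  q≡r*n : q ≡ r * + n
  q≡r*n = _∣_.equality n∣q
  reassoc : ∀ r n m → r * n * m ≡ r * (m * n)
  reassoc = solve-∀

pos-+-* : ∀ a b c → + (a ℕ.+ b ℕ.* c) ≡ + a + + b * + c
pos-+-* a b c = trans (pos-+ a (b ℕ.* c)) (cong (_+_ (+ a)) (pos-* b c))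

residue : ℤ → (n : ℕ) .{{_ : NonZero n}} → Fin n
residue x n = fromℕ< (n%ℕd<d x n)

residue-≈ : ∀ x n .{{_ : NonZero n}} → + toℕ (residue x n) ≈ x mod n
residue-≈ x n = ≈-mod (divides (- q) (begin
  + toℕ (residue x n) - x  ≡⟨ cong (λ r → + r - x) (toℕ-fromℕ< (n%ℕd<d x n)) ⟩
  + r - x                  ≡⟨ cong (_-_ (+ r)) (a≡a%ℕn+[a/ℕn]*n x n) ⟩
  + r - (+ r + q * + n)    ≡⟨ cancel (+ r) q (+ n) ⟩
  - q * + n                ∎))
  where
  open ≡-Reasoning
  r : ℕ
  r = x %ℕ n
  q : ℤ
  q = x /ℕ n
  cancel : ∀ r q n → r - (r + q * n) ≡ - q * n
  cancel = solve-∀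

inverse-mod : ∀ {m n} → Coprime m n → Σ ℤ λ u → + m * u ≈ + 1 mod n
inverse-mod {m} {n} m⊥n with coprime-Bézout m⊥n
... | Bézout.+- x y 1+yn≡xm = + x , ≈-mod (divides (+ y) (begin
  + m * + x - + 1           ≡⟨ cong (_- + 1) (trans (*-comm (+ m) (+ x)) (sym (pos-* x m))) ⟩
  + (x ℕ.* m) - + 1         ≡⟨ cong (λ z → + z - + 1) (sym 1+yn≡xm) ⟩
  + (1 ℕ.+ y ℕ.* n) - + 1   ≡⟨ cong (_- + 1) (pos-+-* 1 y n) ⟩
  + 1 + + y * + n - + 1     ≡⟨ cancel (+ 1) (+ y * + n) ⟩
  + y * + n                 ∎))
  where
  open ≡-Reasoning
  cancel : ∀ a b → a + b - a ≡ b
  cancel = solve-∀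
... | Bézout.-+ x y 1+xm≡yn = - + x , ≈-mod (divides (- + y) (begin
  + m * - + x - + 1         ≡⟨ regroup (+ m) (+ x) (+ 1) ⟩
  - (+ 1 + + x * + m)       ≡⟨ cong -_ (sym (pos-+-* 1 x m)) ⟩
  - + (1 ℕ.+ x ℕ.* m)       ≡⟨ cong (λ z → - + z) 1+xm≡yn ⟩
  - + (y ℕ.* n)             ≡⟨ cong -_ (pos-* y n) ⟩
  - (+ y * + n)             ≡⟨ neg-distribˡ (+ y) (+ n) ⟩
  - + y * + n               ∎))
  where
  open ≡-Reasoning
  regroup : ∀ m x one → m * - x - one ≡ - (one + x * m)
  regroup = solve-∀
  neg-distribˡ : ∀ a b → - (a * b) ≡ - a * b
  neg-distribˡ = solve-∀

branch-root⇒coprime : ∀ {h p} m j → SameRoot (h ℕ.* p) (1 ℕ.+ h ℕ.* m) (p ℕ.* j) → Coprime h p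
branch-root⇒coprime {h} {p} m j branch≈root {d} (d∣h , d∣p) = ℕ.∣1⇒≡1 (∣⇒∣ᵤ (≈0-mod⇒∣ 1≈0))
  where
  open ≈-mod-Reasoning d
  1≈0 : + 1 ≈ + 0 mod d
  1≈0 = begin
    + 1                     ≡⟨ sym (pos-+ 1 0) ⟩
    + 1 + + 0               ≈⟨ +-congˡ-mod (+ 1) (≈-mod-weaken d∣h (multiple≈0-mod (+ m))) ⟨
    + 1 + + h * + m         ≡⟨ pos-+-* 1 h m ⟨
    + (1 ℕ.+ h ℕ.* m)       ≈⟨ ≈-mod-weaken (ℕ.∣-trans d∣h (ℕ.m∣m*n p)) (≈-mod (∣ᵤ⇒∣ branch≈root)) ⟩
    + (p ℕ.* j)             ≡⟨ pos-* p j ⟩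
    + p * + j               ≈⟨ ≈-mod-weaken d∣p (multiple≈0-mod (+ j)) ⟩
    + 0                     ∎

branchExp≈index : ∀ h p k m → + branchExp h p k m ≈ + toℕ k mod h
branchExp≈index h p k m = begin
  + branchExp h p k m             ≡⟨ pos-+-* (toℕ k) h (toℕ m) ⟩
  + toℕ k + + h * + toℕ m         ≈⟨ +-congˡ-mod (+ toℕ k) (multiple≈0-mod (+ toℕ m)) ⟩
  + toℕ k + + 0                   ≡⟨ +-identityʳ (+ toℕ k) ⟩
  + toℕ k                         ∎
  where open ≈-mod-Reasoning h

module _ {h p : ℕ} .{{_ : NonZero h}} .{{_ : NonZero p}} (h⊥p : Coprime h p) where

  private
    h⁻¹ p⁻¹ : ℤ
    h⁻¹ = proj₁ (inverse-mod h⊥p)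
    p⁻¹ = proj₁ (inverse-mod (Coprimality.sym h⊥p))

  coprimeBranches : L h p
  coprimeBranches k = residue (- + toℕ k * h⁻¹) p

  branchExp≈0 : ∀ k → + branchExp h p k (coprimeBranches k) ≈ + 0 mod p
  branchExp≈0 k = begin
    + branchExp h p k (coprimeBranches k)   ≡⟨ pos-+-* (toℕ k) h (toℕ (coprimeBranches k)) ⟩
    K + + h * + toℕ (coprimeBranches k)     ≈⟨ +-congˡ-mod K (*-congˡ-mod (+ h) (residue-≈ _ p)) ⟩
    K + + h * (- K * h⁻¹)                   ≡⟨ regroup K (+ h) h⁻¹ ⟩
    K + - K * (+ h * h⁻¹)                   ≈⟨ +-congˡ-mod K (*-congˡ-mod (- K) (proj₂ (inverse-mod h⊥p))) ⟩
    K + - K * + 1                           ≡⟨ cancel K ⟩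
    + 0                                     ∎
    where
    open ≈-mod-Reasoning p
    K : ℤ
    K = + toℕ k
    regroup : ∀ k h u → k + h * (- k * u) ≡ k + - k * (h * u)
    regroup = solve-∀
    cancel : ∀ k → k + - k * + 1 ≡ + 0
    cancel = solve-∀

  coprimeBranch≈omega : ∀ k j → + toℕ k ≈ + p * + toℕ j mod h →
    SameRoot (h ℕ.* p) (branchExp h p k (coprimeBranches k)) (omegaExp h p j)
  coprimeBranch≈omega k j k≈pj = ∣⇒∣ᵤ (_≈_mod_.∣-difference (≈-mod-*-coprime h⊥p mod-h mod-p))
    where
    mod-h : + branchExp h p k (coprimeBranches k) ≈ + omegaExp h p j mod h
    mod-h = begin
      + branchExp h p k (coprimeBranches k)  ≈⟨ branchExp≈index h p k (coprimeBranches k) ⟩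
      + toℕ k                                ≈⟨ k≈pj ⟩
      + p * + toℕ j                          ≡⟨ pos-* p (toℕ j) ⟨
      + omegaExp h p j                       ∎
      where open ≈-mod-Reasoning h
    mod-p : + branchExp h p k (coprimeBranches k) ≈ + omegaExp h p j mod p
    mod-p = begin
      + branchExp h p k (coprimeBranches k)  ≈⟨ branchExp≈0 k ⟩
      + 0                                    ≈⟨ multiple≈0-mod (+ toℕ j) ⟨
      + p * + toℕ j                          ≡⟨ pos-* p (toℕ j) ⟨
      + omegaExp h p j                       ∎
      where open ≈-mod-Reasoning p

  coprimeBranch-isRoot : ∀ k → Σ (Fin h) λ j →
    SameRoot (h ℕ.* p) (branchExp h p k (coprimeBranches k)) (omegaExp h p j)
  coprimeBranch-isRoot k = j , coprimeBranch≈omega k j (begin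
    K                       ≡⟨ *-identityʳ K ⟨
    K * + 1                 ≈⟨ *-congˡ-mod K (proj₂ (inverse-mod (Coprimality.sym h⊥p))) ⟨
    K * (+ p * p⁻¹)         ≡⟨ regroup K (+ p) p⁻¹ ⟩
    + p * (K * p⁻¹)         ≈⟨ *-congˡ-mod (+ p) (residue-≈ (K * p⁻¹) h) ⟨
    + p * + toℕ j           ∎)
    where
    open ≈-mod-Reasoning h
    K : ℤ
    K = + toℕ k
    j : Fin h
    j = residue (K * p⁻¹) h
    regroup : ∀ k p u → k * (p * u) ≡ p * (k * u)
    regroup = solve-∀

  root-isCoprimeBranch : ∀ j → Σ (Fin h) λ k →
    SameRoot (h ℕ.* p) (branchExp h p k (coprimeBranches k)) (omegaExp h p j)
  root-isCoprimeBranch j = k , coprimeBranch≈omega k j (residue-≈ (+ p * + toℕ j) h)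
    where
    k : Fin h
    k = residue (+ p * + toℕ j) h

theorem13 : (h p : ℕ) → 1 < h → 1 ≤ p →
    (Σ (L h p) (λ l → RootSetEqOmega h p l)) ⇔ (gcd h p ≡ 1)
theorem13 (suc (suc h')) (suc p') (s≤s (s≤s z≤n)) (s≤s z≤n) = mk⇔ coprime-if-equal equal-if-coprime
  where
  h p : ℕ
  h = suc (suc h')
  p = suc p'
  coprime-if-equal : Σ (L h p) (RootSetEqOmega h p) → gcd h p ≡ 1
  coprime-if-equal (l , branches-are-roots , _) =
    let ω¹ = Fin.suc Fin.zero
        (j , f[ω¹]≈ω^j) = branches-are-roots ω¹
    in coprime⇒gcd≡1 (branch-root⇒coprime {h} {p} (toℕ (l ω¹)) (toℕ j) f[ω¹]≈ω^j)
  equal-if-coprime : gcd h p ≡ 1 → Σ (L h p) (RootSetEqOmega h p)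
  equal-if-coprime gcd≡1 =
    let h⊥p = gcd≡1⇒coprime gcd≡1
    in coprimeBranches h⊥p , coprimeBranch-isRoot h⊥p , root-isCoprimeBranch h⊥p
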